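{- Let $p=(12,\{(0,0),(0,1),(1,0),(1,1)\})$. For every $n\ge 2$, \[\sum_{\pi\in S_n(p)} x^{\operatorname{des}(\pi)} = x\,E_{n-1}(x).\] Moreover $|S_n(p)|=(n-1)!$ for all $n\ge1$.
   Context: $S_n$ is the set of permutations of $\{1,\dots,n\}$, written $\pi=\pi_1\cdots\pi_n$; $\operatorname{des}(\pi)$ is the number of indices $i$ with $\pi_i>\pi_{i+1}$. A mesh pattern $(12,R)$ of length 2 has $R\subseteq\{0,1,2\}^2$ (shaded boxes). A permutation $\pi\in S_n$ contains $(12,R)$ if there exist indices $i<j$ with $\pi_i<\pi_j$ such that, with $p_0=0,p_1=i,p_2=j,p_3=n+1$ and $v_0=0,v_1=\pi_i,v_2=\pi_j,v_3=n+1$, for every $(a,b)\in R$ there is no index $x$ with $p_a<x<p_{a+1}$ and $v_b<\pi_x<v_{b+1}$. Otherwise $\pi$ avoids it; $S_n(p)$ is the set of avoiders in $S_n$. The Eulerian polynomials $E_m(x)$ are defined by $\sum_{k\ge0}(k+1)^m x^k = E_m(x)/(1-x)^{m+1}$. -}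

module Defs where

open import Data.Bool using (Bool; true; false; not; _∧_; _∨_; if_then_else_)
open import Data.Nat using (ℕ; zero; suc; _+_; _∸_; _^_; _<ᵇ_; _≡ᵇ_)
open import Data.Fin using (Fin; toℕ)
import Data.Fin as Fin
open import Data.Vec using (Vec; []; _∷_; lookup; toList)
open import Data.List using (List; []; _∷_; [_]; map; concatMap; filterᵇ; length; allFin; upTo; foldr)
open import Data.Bool.ListAction using (all; any)
open import Data.Product using (_×_; _,_)
open import Data.Integer as ℤ using (ℤ; +_; -[1+_])

-- Permutations of {1,…,n}, represented as words π = π₁ ⋯ πₙ given by
-- the vector of values; value v : Fin n stands for the integer toℕ v + 1
-- and index i : Fin n stands for position toℕ i + 1.

words : (n k : ℕ) → List (Vec (Fin n) k)
words n zero    = [ [] ]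
words n (suc k) = concatMap (λ a → map (a ∷_) (words n k)) (allFin n)

pos : {n : ℕ} → Fin n → ℕ
pos i = suc (toℕ i)

-- π is a permutation iff it is injective (hence bijective on Fin n)
isPerm : {n : ℕ} → Vec (Fin n) n → Bool
isPerm {n} π = all (λ i → all (λ j → not (pos i <ᵇ pos j) ∨
                                      not (pos (lookup π i) ≡ᵇ pos (lookup π j)))
                              (allFin n))
                   (allFin n)

S : (n : ℕ) → List (Vec (Fin n) n)
S n = filterᵇ isPerm (words n n)

desL : List ℕ → ℕ
desL (a ∷ b ∷ t) = (if b <ᵇ a then 1 else 0) + desL (b ∷ t)
desL _           = 0

des : {n : ℕ} → Vec (Fin n) n → ℕ
des π = desL (map (λ v → pos v) (toList π))

-- Mesh patterns (12, R) of length 2, R ⊆ {0,1,2}², as a list of boxes.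

MeshR : Set
MeshR = List (Fin 3 × Fin 3)

between : ℕ → ℕ → ℕ → Bool
between lo x hi = (lo <ᵇ x) ∧ (x <ᵇ hi)

-- π contains (12,R): there are i < j with πᵢ < πⱼ such that each shaded box
-- (a,b) ∈ R contains no point (x, πₓ) with p_a < x < p_{a+1},
-- v_b < πₓ < v_{b+1}, where p = (0,i,j,n+1), v = (0,πᵢ,πⱼ,n+1) (1-based).
contains12 : {n : ℕ} → MeshR → Vec (Fin n) n → Bool
contains12 {n} R π =
  any (λ i → any (λ j → occ i j) (allFin n)) (allFin n)
  where
    bd : ℕ → ℕ → Fin 4 → ℕ
    bd l h Fin.zero                    = 0
    bd l h (Fin.suc Fin.zero)          = l
    bd l h (Fin.suc (Fin.suc Fin.zero)) = h
    bd l h (Fin.suc (Fin.suc (Fin.suc Fin.zero))) = suc n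
    emptyBox : Fin n → Fin n → Fin 3 × Fin 3 → Bool
    emptyBox i j (a , b) =
      not (any (λ x → between (bd (pos i) (pos j) (Fin.inject₁ a)) (pos x)
                                (bd (pos i) (pos j) (Fin.suc a))
                      ∧ between (bd (pos (lookup π i)) (pos (lookup π j)) (Fin.inject₁ b))
                                (pos (lookup π x))
                                (bd (pos (lookup π i)) (pos (lookup π j)) (Fin.suc b)))
               (allFin n))
    occ : Fin n → Fin n → Bool
    occ i j = (pos i <ᵇ pos j) ∧ (pos (lookup π i) <ᵇ pos (lookup π j))
              ∧ all (emptyBox i j) R

avoids12 : {n : ℕ} → MeshR → Vec (Fin n) n → Bool
avoids12 R π = not (contains12 R π)

Av : (n : ℕ) → MeshR → List (Vec (Fin n) n)
Av n R = filterᵇ (avoids12 R) (S n)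

pR : MeshR
pR = (Fin.zero , Fin.zero) ∷ (Fin.zero , Fin.suc Fin.zero)
   ∷ (Fin.suc Fin.zero , Fin.zero) ∷ (Fin.suc Fin.zero , Fin.suc Fin.zero) ∷ []

-- Formal power series over ℤ as coefficient sequences.

Ser : Set
Ser = ℕ → ℤ

sumℤ : List ℤ → ℤ
sumℤ = foldr ℤ._+_ (+ 0)

_⊛_ : Ser → Ser → Ser
(f ⊛ g) j = sumℤ (map (λ i → f i ℤ.* g (j ∸ i)) (upTo (suc j)))

oneS : Ser
oneS zero    = + 1
oneS (suc _) = + 0

oneMinusX : Ser
oneMinusX zero          = + 1
oneMinusX (suc zero)    = -[1+ 0 ]
oneMinusX (suc (suc _)) = + 0

powS : Ser → ℕ → Ser
powS f zero    = oneS
powS f (suc m) = f ⊛ powS f m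

-- Eulerian polynomial E_m, defined by Σ_k (k+1)^m x^k = E_m(x)/(1-x)^{m+1},
-- i.e. E_m(x) = (1-x)^{m+1} · Σ_k (k+1)^m x^k as formal power series.
E : ℕ → Ser
E m = powS oneMinusX (suc m) ⊛ (λ k → + (suc k ^ m))

xTimes : Ser → Ser
xTimes f zero    = + 0
xTimes f (suc k) = f k

desGF : {n : ℕ} → List (Vec (Fin n) n) → Ser
desGF L k = + length (filterᵇ (λ π → des π ≡ᵇ k) L)

-- An occurrence of p at positions i < j says exactly that π_i is the only entry left of
-- π_j that is smaller than π_j, so π avoids p iff no entry has exactly one smaller entry
-- to its left.  Deleting the maximum from an avoider leaves an avoider, and the maximum
-- can be put back anywhere except directly after the first entry: this gives n - 1
-- choices at length n, whence (n - 1)!.  An avoider of length n ≥ 2 starts with a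
-- descent, so of the n admissible insertions of the new maximum, des σ keep the number
-- of descents and n - des σ raise it by one.  That is the recurrence of the Eulerian
-- numbers, which the coefficients of x E_{n-1}(x) satisfy since E_m is the (m+1)-fold
-- difference of the sequence k ↦ (k + 1)^m.

module Submission where

open import Defs

-- Eulerian polynomials

module Eulerian where

  open import Data.Nat using (ℕ; zero; suc; _∸_; _^_)
  open import Data.Integer using (ℤ; +_; -[1+_]; _+_; _*_; _-_)
  open import Data.Integer.Properties using (pos-+; pos-*; +-identityʳ; *-identityˡ; *-zeroʳ)
  open import Data.Integer.Tactic.RingSolver using (solve-∀)
  open import Data.List using (map; applyUpTo)
  open import Function using (_∘_; id)
  open import Relation.Binary.PropositionalEquality

  sum< : ℕ → (ℕ → ℤ) → ℤ
  sum< zero    f = + 0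
  sum< (suc n) f = f 0 + sum< n (f ∘ suc)

  sumℤ-map-applyUpTo : ∀ (f : ℕ → ℤ) (g : ℕ → ℕ) n → sumℤ (map f (applyUpTo g n)) ≡ sum< n (f ∘ g)
  sumℤ-map-applyUpTo f g zero    = refl
  sumℤ-map-applyUpTo f g (suc n) = cong (_+_ (f (g 0))) (sumℤ-map-applyUpTo f (g ∘ suc) n)

  ⊛-as-sum< : ∀ (f g : Ser) j → (f ⊛ g) j ≡ sum< (suc j) (λ i → f i * g (j ∸ i))
  ⊛-as-sum< f g j = sumℤ-map-applyUpTo (λ i → f i * g (j ∸ i)) id (suc j)

  sum<-cong : ∀ n {f g : ℕ → ℤ} → (∀ i → f i ≡ g i) → sum< n f ≡ sum< n g
  sum<-cong zero    f≗g = refl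
  sum<-cong (suc n) f≗g = cong₂ _+_ (f≗g 0) (sum<-cong n (f≗g ∘ suc))

  sum<-zero : ∀ n {f : ℕ → ℤ} → (∀ i → f i ≡ + 0) → sum< n f ≡ + 0
  sum<-zero zero    f≗0 = refl
  sum<-zero (suc n) f≗0 = cong₂ _+_ (f≗0 0) (sum<-zero n (f≗0 ∘ suc))

  sum<-- : ∀ n (f g : ℕ → ℤ) → sum< n (λ i → f i - g i) ≡ sum< n f - sum< n g
  sum<-- zero    f g = refl
  sum<-- (suc n) f g = begin
    (f 0 - g 0) + sum< n (λ i → f (suc i) - g (suc i))
      ≡⟨ cong (_+_ (f 0 - g 0)) (sum<-- n (f ∘ suc) (g ∘ suc)) ⟩
    (f 0 - g 0) + (sum< n (f ∘ suc) - sum< n (g ∘ suc))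
      ≡⟨ interchange (f 0) (g 0) _ _ ⟩
    (f 0 + sum< n (f ∘ suc)) - (g 0 + sum< n (g ∘ suc)) ∎
    where
    open ≡-Reasoning
    interchange : ∀ a b c d → (a - b) + (c - d) ≡ (a + c) - (b + d)
    interchange = solve-∀

  Δ : Ser → Ser
  Δ f zero    = f zero
  Δ f (suc k) = f (suc k) - f k

  Δ^ : ℕ → Ser → Ser
  Δ^ zero    f = f
  Δ^ (suc r) f = Δ (Δ^ r f)

  Δ-cong : ∀ {f g} → f ≗ g → Δ f ≗ Δ g
  Δ-cong f≗g zero    = f≗g zero
  Δ-cong f≗g (suc k) = cong₂ _-_ (f≗g (suc k)) (f≗g k)

  Δ^-cong : ∀ r {f g} → f ≗ g → Δ^ r f ≗ Δ^ r g
  Δ^-cong zero    f≗g = f≗g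
  Δ^-cong (suc r) f≗g = Δ-cong (Δ^-cong r f≗g)

  ⊛-congˡ : ∀ {f g} h → f ≗ g → f ⊛ h ≗ g ⊛ h
  ⊛-congˡ {f} {g} h f≗g j = begin
    (f ⊛ h) j                                 ≡⟨ ⊛-as-sum< f h j ⟩
    sum< (suc j) (λ i → f i * h (j ∸ i))      ≡⟨ sum<-cong (suc j) (λ i → cong (_* h (j ∸ i)) (f≗g i)) ⟩
    sum< (suc j) (λ i → g i * h (j ∸ i))      ≡⟨ ⊛-as-sum< g h j ⟨
    (g ⊛ h) j                                 ∎
    where open ≡-Reasoning

  oneS-⊛ : ∀ h → oneS ⊛ h ≗ h
  oneS-⊛ h j = begin
    (oneS ⊛ h) j                                          ≡⟨ ⊛-as-sum< oneS h j ⟩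
    + 1 * h j + sum< j (λ i → oneS (suc i) * h (j ∸ suc i)) ≡⟨ cong (_+_ (+ 1 * h j)) (sum<-zero j (λ _ → refl)) ⟩
    + 1 * h j + + 0                                        ≡⟨ +-identityʳ _ ⟩
    + 1 * h j                                              ≡⟨ *-identityˡ (h j) ⟩
    h j                                                    ∎
    where open ≡-Reasoning

  oneMinusX-⊛ : ∀ h → oneMinusX ⊛ h ≗ Δ h
  oneMinusX-⊛ h zero    = trans (⊛-as-sum< oneMinusX h 0) (trans (+-identityʳ _) (*-identityˡ (h 0)))
  oneMinusX-⊛ h (suc k) = begin
    (oneMinusX ⊛ h) (suc k)                           ≡⟨ ⊛-as-sum< oneMinusX h (suc k) ⟩
    + 1 * h (suc k) + (-[1+ 0 ] * h k + sum< k _)     ≡⟨ cong (λ s → + 1 * h (suc k) + (-[1+ 0 ] * h k + s)) (sum<-zero k (λ _ → refl)) ⟩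
    + 1 * h (suc k) + (-[1+ 0 ] * h k + + 0)          ≡⟨ normalise (h (suc k)) (h k) ⟩
    h (suc k) - h k                                   ∎
    where
    open ≡-Reasoning
    normalise : ∀ a b → + 1 * a + (-[1+ 0 ] * b + + 0) ≡ a - b
    normalise = solve-∀

  Δ-⊛ : ∀ g h → Δ g ⊛ h ≗ Δ (g ⊛ h)
  Δ-⊛ g h zero    = trans (⊛-as-sum< (Δ g) h 0) (sym (⊛-as-sum< g h 0))
  Δ-⊛ g h (suc j) = begin
    (Δ g ⊛ h) (suc j)
      ≡⟨ ⊛-as-sum< (Δ g) h (suc j) ⟩
    g 0 * h (suc j) + sum< (suc j) (λ i → (g (suc i) - g i) * h (j ∸ i))
      ≡⟨ cong (_+_ (g 0 * h (suc j))) (sum<-cong (suc j) (λ i → *-distribʳ-- (g (suc i)) (g i) (h (j ∸ i)))) ⟩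
    g 0 * h (suc j) + sum< (suc j) (λ i → g (suc i) * h (j ∸ i) - g i * h (j ∸ i))
      ≡⟨ cong (_+_ (g 0 * h (suc j))) (sum<-- (suc j) (λ i → g (suc i) * h (j ∸ i)) (λ i → g i * h (j ∸ i))) ⟩
    g 0 * h (suc j) + (sum< (suc j) (λ i → g (suc i) * h (j ∸ i)) - sum< (suc j) (λ i → g i * h (j ∸ i)))
      ≡⟨ +-‿assoc (g 0 * h (suc j)) _ _ ⟩
    (g 0 * h (suc j) + sum< (suc j) (λ i → g (suc i) * h (j ∸ i))) - sum< (suc j) (λ i → g i * h (j ∸ i))
      ≡⟨ cong₂ _-_ (⊛-as-sum< g h (suc j)) (⊛-as-sum< g h j) ⟨
    Δ (g ⊛ h) (suc j) ∎
    where
    open ≡-Reasoning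
    *-distribʳ-- : ∀ a b c → (a - b) * c ≡ a * c - b * c
    *-distribʳ-- = solve-∀
    +-‿assoc : ∀ a b c → a + (b - c) ≡ (a + b) - c
    +-‿assoc = solve-∀

  powS-oneMinusX-⊛ : ∀ r h → powS oneMinusX r ⊛ h ≗ Δ^ r h
  powS-oneMinusX-⊛ zero    h = oneS-⊛ h
  powS-oneMinusX-⊛ (suc r) h k = begin
    ((oneMinusX ⊛ powS oneMinusX r) ⊛ h) k ≡⟨ ⊛-congˡ h (oneMinusX-⊛ (powS oneMinusX r)) k ⟩
    (Δ (powS oneMinusX r) ⊛ h) k           ≡⟨ Δ-⊛ (powS oneMinusX r) h k ⟩
    Δ (powS oneMinusX r ⊛ h) k             ≡⟨ Δ-cong (powS-oneMinusX-⊛ r h) k ⟩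
    Δ^ (suc r) h k                         ∎
    where open ≡-Reasoning

  powers : ℕ → Ser
  powers m k = + (suc k ^ m)

  E≗Δ^powers : ∀ m → E m ≗ Δ^ (suc m) (powers m)
  E≗Δ^powers m = powS-oneMinusX-⊛ (suc m) (powers m)

  weighted : Ser → Ser
  weighted f k = + suc k * f k

  powers-suc : ∀ m → powers (suc m) ≗ weighted (powers m)
  powers-suc m k = pos-* (suc k) (suc k ^ m)

  +suc : ∀ n → + suc n ≡ + 1 + + n
  +suc n = pos-+ 1 n

  +2+ : ∀ n → + suc (suc n) ≡ + 1 + (+ 1 + + n)
  +2+ n = trans (+suc (suc n)) (cong (_+_ (+ 1)) (+suc n))

  Δ-weighted : ∀ f → Δ (weighted f) ≗ λ k → weighted (Δ f) k + xTimes f k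
  Δ-weighted f zero    = sym (+-identityʳ _)
  Δ-weighted f (suc k) = begin
    + suc (suc k) * f (suc k) - + suc k * f k
      ≡⟨ cong₂ (λ a b → a * f (suc k) - b * f k) (+2+ k) (+suc k) ⟩
    (+ 1 + (+ 1 + + k)) * f (suc k) - (+ 1 + + k) * f k
      ≡⟨ normalise (+ k) (f (suc k)) (f k) ⟩
    (+ 1 + (+ 1 + + k)) * (f (suc k) - f k) + f k
      ≡⟨ cong (λ a → a * (f (suc k) - f k) + f k) (+2+ k) ⟨
    + suc (suc k) * (f (suc k) - f k) + f k ∎
    where
    open ≡-Reasoning
    normalise : ∀ a x y → (+ 1 + (+ 1 + a)) * x - (+ 1 + a) * y ≡ (+ 1 + (+ 1 + a)) * (x - y) + y
    normalise = solve-∀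

  Δ^-weighted : ∀ r f → Δ^ (suc r) (weighted f) ≗ λ k → weighted (Δ^ (suc r) f) k + + suc r * xTimes (Δ^ r f) k
  Δ^-weighted zero    f k = trans (Δ-weighted f k) (cong (_+_ (weighted (Δ f) k)) (sym (*-identityˡ _)))
  Δ^-weighted (suc r) f zero = begin
    Δ^ (suc r) (weighted f) 0
      ≡⟨ Δ^-weighted r f 0 ⟩
    weighted (Δ^ (suc r) f) 0 + + suc r * + 0
      ≡⟨ cong (_+_ (weighted (Δ^ (suc r) f) 0)) (trans (*-zeroʳ (+ suc r)) (sym (*-zeroʳ (+ suc (suc r))))) ⟩
    weighted (Δ^ (suc r) f) 0 + + suc (suc r) * + 0 ∎
    where open ≡-Reasoning
  Δ^-weighted (suc r) f (suc k) = begin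
    Δ^ (suc r) (weighted f) (suc k) - Δ^ (suc r) (weighted f) k
      ≡⟨ cong₂ _-_ (Δ^-weighted r f (suc k)) (Δ^-weighted r f k) ⟩
    (weighted g (suc k) + c * xTimes h (suc k)) - (weighted g k + c * xTimes h k)
      ≡⟨ regroup (weighted g (suc k)) (weighted g k) c (xTimes h (suc k)) (xTimes h k) ⟩
    (weighted g (suc k) - weighted g k) + c * (xTimes h (suc k) - xTimes h k)
      ≡⟨ cong₂ (λ a b → a + c * b) (Δ-weighted g (suc k)) (Δ-xTimes k) ⟩
    (weighted (Δ g) (suc k) + xTimes g (suc k)) + c * xTimes g (suc k)
      ≡⟨ collect (weighted (Δ g) (suc k)) (xTimes g (suc k)) c ⟩
    weighted (Δ g) (suc k) + (+ 1 + c) * xTimes g (suc k)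
      ≡⟨ cong (λ a → weighted (Δ g) (suc k) + a * xTimes g (suc k)) (+suc (suc r)) ⟨
    weighted (Δ g) (suc k) + + suc (suc r) * xTimes g (suc k) ∎
    where
    open ≡-Reasoning
    g h : Ser
    g = Δ^ (suc r) f
    h = Δ^ r f
    c : ℤ
    c = + suc r
    Δ-xTimes : ∀ k → xTimes h (suc k) - xTimes h k ≡ xTimes g (suc k)
    Δ-xTimes zero    = +-identityʳ _
    Δ-xTimes (suc k) = refl
    regroup : ∀ a b c x y → (a + c * x) - (b + c * y) ≡ (a - b) + c * (x - y)
    regroup = solve-∀
    collect : ∀ a x c → (a + x) + c * x ≡ a + (+ 1 + c) * x
    collect = solve-∀

  E-suc : ∀ m k → E (suc m) k ≡ + suc k * Δ (E m) k + + suc (suc m) * xTimes (E m) k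
  E-suc m k = begin
    E (suc m) k                                        ≡⟨ E≗Δ^powers (suc m) k ⟩
    Δ^ (suc (suc m)) (powers (suc m)) k                ≡⟨ Δ^-cong (suc (suc m)) (powers-suc m) k ⟩
    Δ^ (suc (suc m)) (weighted (powers m)) k           ≡⟨ Δ^-weighted (suc m) (powers m) k ⟩
    + suc k * Δ (Δ^ (suc m) (powers m)) k + + suc (suc m) * xTimes (Δ^ (suc m) (powers m)) k
      ≡⟨ cong₂ (λ a b → + suc k * a + + suc (suc m) * b) (Δ-cong (E≗Δ^powers m) k) (xTimes-E k) ⟨
    + suc k * Δ (E m) k + + suc (suc m) * xTimes (E m) k ∎
    where
    open ≡-Reasoning
    xTimes-E : ∀ k → xTimes (E m) k ≡ xTimes (Δ^ (suc m) (powers m)) k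
    xTimes-E zero    = refl
    xTimes-E (suc k) = E≗Δ^powers m k

  E-suc-zero : ∀ m → E (suc m) 0 ≡ E m 0
  E-suc-zero m = trans (E-suc m 0) (normalise (E m 0) (+ suc (suc m)))
    where
    normalise : ∀ a c → + 1 * a + c * + 0 ≡ a
    normalise = solve-∀

  E-suc-suc : ∀ m k → E (suc m) (suc k) ≡ + suc (suc k) * E m (suc k) + (+ m - + k) * E m k
  E-suc-suc m k = begin
    E (suc m) (suc k)
      ≡⟨ E-suc m (suc k) ⟩
    + suc (suc k) * (E m (suc k) - E m k) + + suc (suc m) * E m k
      ≡⟨ cong₂ (λ a b → a * (E m (suc k) - E m k) + b * E m k) (+2+ k) (+2+ m) ⟩
    (+ 1 + (+ 1 + + k)) * (E m (suc k) - E m k) + (+ 1 + (+ 1 + + m)) * E m k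
      ≡⟨ normalise (+ k) (+ m) (E m (suc k)) (E m k) ⟩
    (+ 1 + (+ 1 + + k)) * E m (suc k) + (+ m - + k) * E m k
      ≡⟨ cong (λ a → a * E m (suc k) + (+ m - + k) * E m k) (+2+ k) ⟨
    + suc (suc k) * E m (suc k) + (+ m - + k) * E m k ∎
    where
    open ≡-Reasoning
    normalise : ∀ a b x y → (+ 1 + (+ 1 + a)) * (x - y) + (+ 1 + (+ 1 + b)) * y ≡ (+ 1 + (+ 1 + a)) * x + (b - a) * y
    normalise = solve-∀

  E-zero : E 0 ≗ oneS
  E-zero zero    = E≗Δ^powers 0 0
  E-zero (suc k) = E≗Δ^powers 0 (suc k)

  E-one : E 1 ≗ oneS
  E-one zero    = trans (E-suc-zero 0) (E-zero 0)
  E-one (suc k) = begin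
    E 1 (suc k)
      ≡⟨ E-suc-suc 0 k ⟩
    + suc (suc k) * E 0 (suc k) + (+ 0 - + k) * E 0 k
      ≡⟨ cong₂ (λ a b → + suc (suc k) * a + (+ 0 - + k) * b) (E-zero (suc k)) (E-zero k) ⟩
    + suc (suc k) * + 0 + (+ 0 - + k) * oneS k
      ≡⟨ vanish k ⟩
    + 0 ∎
    where
    open ≡-Reasoning
    vanish : ∀ k → + suc (suc k) * + 0 + (+ 0 - + k) * oneS k ≡ + 0
    vanish zero    = refl
    vanish (suc k) = cong₂ _+_ (*-zeroʳ (+ suc (suc (suc k)))) (*-zeroʳ (+ 0 - + suc k))

open import Data.Bool using (Bool; true; false; not; _∧_; _∨_; if_then_else_; T; T?)
open import Data.Bool.Properties using (∧-comm; ∧-zeroʳ; T-≡; T-not-≡)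
open import Data.Bool.ListAction using (all; any)
open import Data.Nat using (ℕ; zero; suc; _+_; _*_; _!; _∸_; _<ᵇ_; _≡ᵇ_; _<_; _≤_; z≤n; s≤s; s≤s⁻¹; _≟_; _≤?_)
open import Data.Nat.Properties
  using (<⇒<ᵇ; <ᵇ⇒<; ≡ᵇ⇒≡; ≡⇒≡ᵇ; <⇒≤; <-irrefl; ≤-refl; ≤-trans; <-trans; <⇒≱; <-cmp; ≰⇒>; ≤∧≢⇒<; >⇒≢; <⇒≢;
         m≤n⇒m≤1+n; m≤n⇒m⊓n≡m; suc-injective; +-suc; +-identityʳ; +-∸-assoc; *-zeroʳ; *-suc; *-identityˡ)
open import Data.Nat.Tactic.RingSolver using (solve-∀)
open import Data.Integer as ℤ using (ℤ; +_)
import Data.Integer.Properties as ℤ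
open import Data.Fin as Fin using (Fin; toℕ; fromℕ<)
open import Data.Fin.Properties using (toℕ-fromℕ<; toℕ-injective; toℕ<n)
open import Data.Vec as Vec using (Vec; []; _∷_; lookup; toList)
open import Data.Vec.Properties using (length-toList)
import Data.Vec.Properties as Vec
open import Data.List using (List; []; _∷_; map; concatMap; filterᵇ; length; _++_; replicate; allFin; take)
open import Data.List.Properties
  using (length-++; length-map; length-++-sucʳ; length-take; map-∘; map-++; map-cong; map-replicate; filter-++; filter-none;
         ∷-injectiveˡ; ∷-injectiveʳ)
open import Data.List.Relation.Unary.All as All using (All; []; _∷_)
import Data.List.Relation.Unary.All.Properties as All
open import Data.List.Relation.Unary.Any using (here; there)
import Data.List.Relation.Unary.Any.Properties as Any
open import Data.List.Relation.Unary.Unique.Propositional using (Unique; []; _∷_)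
import Data.List.Relation.Unary.Unique.Propositional.Properties as Unique
open import Data.List.Membership.Propositional using (_∈_; _∉_; find; lose)
open import Data.List.Membership.Propositional.Properties
  using (∈-map⁺; ∈-map⁻; ∈-concat⁻; ∈-concat⁺′; ∈-∃++; ∈-allFin; ∈-filter⁺; ∈-filter⁻)
open import Data.List.Membership.Propositional.Properties.WithK using (unique∧set⇒bag)
open import Data.List.Membership.DecPropositional _≟_ using (_∈?_)
open import Data.List.Relation.Binary.BagAndSetEquality using (∼bag⇒↭)
open import Data.List.Relation.Binary.Permutation.Propositional
  using (_↭_; ↭-refl; ↭-sym; ↭-trans; ↭-prep; ↭⇒↭ₛ; ↭ₛ⇒↭)
open import Data.List.Relation.Binary.Permutation.Propositional.Properties using (shift; ↭-length)
import Data.List.Relation.Binary.Permutation.Propositional.Properties as ↭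
import Data.List.Relation.Binary.Permutation.Setoid.Properties as ↭ₛ
open import Data.Product using (∃; ∃₂; _×_; _,_; proj₁; proj₂)
open import Data.Sum using (_⊎_; inj₁; inj₂)
open import Data.Empty using (⊥; ⊥-elim)
open import Function using (_∘_; Equivalence; mk⇔; case_of_)
open import Relation.Binary.Definitions using (tri<; tri≈; tri>)
open import Relation.Nullary using (¬_; yes; no)
open import Relation.Binary.PropositionalEquality

open Equivalence
open Eulerian using (E-one; E-suc-zero; E-suc-suc)

<⇒<ᵇ≡true : ∀ {m n} → m < n → (m <ᵇ n) ≡ true
<⇒<ᵇ≡true m<n = T-≡ .to (<⇒<ᵇ m<n)

<ᵇ≡true⇒< : ∀ {m n} → (m <ᵇ n) ≡ true → m < n
<ᵇ≡true⇒< {m} {n} e = <ᵇ⇒< m n (T-≡ .from e)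

≤⇒>ᵇ≡false : ∀ {m n} → n ≤ m → (m <ᵇ n) ≡ false
≤⇒>ᵇ≡false {m}     {zero}  _         = refl
≤⇒>ᵇ≡false {suc m} {suc n} (s≤s n≤m) = ≤⇒>ᵇ≡false n≤m

<ᵇ≡false⇒≥ : ∀ m n → (m <ᵇ n) ≡ false → n ≤ m
<ᵇ≡false⇒≥ m       zero    _ = z≤n
<ᵇ≡false⇒≥ (suc m) (suc n) e = s≤s (<ᵇ≡false⇒≥ m n e)

≡ᵇ-refl : ∀ m → (m ≡ᵇ m) ≡ true
≡ᵇ-refl m = T-≡ .to (≡⇒≡ᵇ m m refl)

≡ᵇ≡true⇒≡ : ∀ m n → (m ≡ᵇ n) ≡ true → m ≡ n
≡ᵇ≡true⇒≡ m n e = ≡ᵇ⇒≡ m n (T-≡ .from e)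

≢⇒≡ᵇ≡false : ∀ m n → m ≢ n → (m ≡ᵇ n) ≡ false
≢⇒≡ᵇ≡false zero    zero    m≢n = ⊥-elim (m≢n refl)
≢⇒≡ᵇ≡false zero    (suc n) _   = refl
≢⇒≡ᵇ≡false (suc m) zero    _   = refl
≢⇒≡ᵇ≡false (suc m) (suc n) m≢n = ≢⇒≡ᵇ≡false m n (m≢n ∘ cong suc)

∧≡true⇒ : ∀ {x y} → x ∧ y ≡ true → x ≡ true × y ≡ true
∧≡true⇒ {true} {true} _ = refl , refl

∧≡true⇐ : ∀ {x y} → x ≡ true → y ≡ true → x ∧ y ≡ true
∧≡true⇐ refl refl = refl

all-true⇒ : ∀ {A : Set} (f : A → Bool) xs → all f xs ≡ true → ∀ {x} → x ∈ xs → f x ≡ true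
all-true⇒ f xs e x∈ = T-≡ .to (All.lookup (All.all⁺ f xs (T-≡ .from e)) x∈)

⇒all-true : ∀ {A : Set} (f : A → Bool) xs → (∀ {x} → x ∈ xs → f x ≡ true) → all f xs ≡ true
⇒all-true f xs h = T-≡ .to (All.all⁻ f (All.tabulate (T-≡ .from ∘ h)))

any-true⇒ : ∀ {A : Set} (f : A → Bool) xs → any f xs ≡ true → ∃ λ x → x ∈ xs × f x ≡ true
any-true⇒ f xs e with find (Any.any⁻ f xs (T-≡ .from e))
... | x , x∈ , fx = x , x∈ , T-≡ .to fx

⇒any-true : ∀ {A : Set} (f : A → Bool) xs {x} → x ∈ xs → f x ≡ true → any f xs ≡ true
⇒any-true f xs x∈ fx = T-≡ .to (Any.any⁺ f (lose x∈ (T-≡ .from fx)))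

not-any⇒ : ∀ {A : Set} (f : A → Bool) xs → not (any f xs) ≡ true → ∀ {x} → x ∈ xs → f x ≢ true
not-any⇒ f xs none x∈ fx with trans (sym (⇒any-true f xs x∈ fx)) (T-not-≡ .to (T-≡ .from none))
... | ()

⇒any-false : ∀ {A : Set} (f : A → Bool) xs → (∀ {x} → x ∈ xs → f x ≢ true) → any f xs ≡ false
⇒any-false f xs h with any f xs in eq
... | false = refl
... | true with any-true⇒ f xs eq
...   | x , x∈ , fx = ⊥-elim (h x∈ fx)

<ᵇ∧<ᵇ : ∀ {a b c d} → a < b → c < d → (a <ᵇ b) ∧ (c <ᵇ d) ≡ true
<ᵇ∧<ᵇ a<b c<d = ∧≡true⇐ (<⇒<ᵇ≡true a<b) (<⇒<ᵇ≡true c<d)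

∈-concatMap⁺ : ∀ {A B : Set} (f : A → List B) {xs x y} → x ∈ xs → y ∈ f x → y ∈ concatMap f xs
∈-concatMap⁺ f x∈ y∈ = ∈-concat⁺′ y∈ (∈-map⁺ f x∈)

∈-concatMap⁻ : ∀ {A B : Set} (f : A → List B) xs {y} → y ∈ concatMap f xs → ∃ λ x → x ∈ xs × y ∈ f x
∈-concatMap⁻ f xs y∈ = find (Any.map⁻ (∈-concat⁻ (map f xs) y∈))

concatMap-unique : ∀ {A B : Set} (f : A → List B) {xs} → Unique xs → (∀ {x} → x ∈ xs → Unique (f x)) →
  (∀ {x x′ y} → x ∈ xs → x′ ∈ xs → y ∈ f x → y ∈ f x′ → x ≡ x′) → Unique (concatMap f xs)
concatMap-unique f {[]}     _          _    _        = []
concatMap-unique f {x ∷ xs} (x∉ ∷ uxs) u-f  disjoint =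
  Unique.++⁺ (u-f (here refl)) (concatMap-unique f uxs (u-f ∘ there) (λ p q → disjoint (there p) (there q))) apart
  where
  apart : ∀ {y} → y ∈ f x × y ∈ concatMap f xs → ⊥
  apart (y∈fx , y∈rest) with ∈-concatMap⁻ f xs y∈rest
  ... | x′ , x′∈ , y∈fx′ with disjoint (here refl) (there x′∈) y∈fx y∈fx′
  ... | refl = All.lookup x∉ x′∈ refl

All-insert : ∀ {P : ℕ → Set} (u : List ℕ) {v m} → All P (u ++ v) → P m → All P (u ++ m ∷ v)
All-insert u all pm = All.++⁺ (All.++⁻ˡ u all) (pm ∷ All.++⁻ʳ u all)

All-remove : ∀ {P : ℕ → Set} (u : List ℕ) {v m} → All P (u ++ m ∷ v) → P m × All P (u ++ v)
All-remove u all with All.++⁻ʳ u all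
... | pm ∷ pv = pm , All.++⁺ (All.++⁻ˡ u all) pv

Unique-insert : ∀ (u : List ℕ) {v m} → Unique (u ++ v) → All (m ≢_) (u ++ v) → Unique (u ++ m ∷ v)
Unique-insert []      uv        m∉         = m∉ ∷ uv
Unique-insert (x ∷ u) (x∉ ∷ uv) (m≢x ∷ m∉) = All-insert u x∉ (m≢x ∘ sym) ∷ Unique-insert u uv m∉

Unique-remove : ∀ (u : List ℕ) {v m} → Unique (u ++ m ∷ v) → Unique (u ++ v) × All (m ≢_) (u ++ v)
Unique-remove []      (m∉ ∷ uv) = uv , m∉
Unique-remove (x ∷ u) (x∉ ∷ uv) with Unique-remove u uv | All-remove u x∉
... | uv′ , m∉ | x≢m , x∉′ = x∉′ ∷ uv′ , (x≢m ∘ sym) ∷ m∉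

dropSecond : ∀ {A : Set} → List A → List A
dropSecond (x ∷ y ∷ xs) = x ∷ xs
dropSecond xs           = xs

Unique-dropSecond : ∀ {A : Set} {xs : List A} → Unique xs → Unique (dropSecond xs)
Unique-dropSecond {xs = []}         u                     = u
Unique-dropSecond {xs = x ∷ []}     u                     = u
Unique-dropSecond {xs = x ∷ y ∷ xs} ((_ ∷ x∉) ∷ (_ ∷ u)) = x∉ ∷ u

remove : ℕ → List ℕ → List ℕ
remove m = filterᵇ (λ y → not (y ≡ᵇ m))

remove-∉ : ∀ m v → All (_≢ m) v → remove m v ≡ v
remove-∉ m []      []          = refl
remove-∉ m (a ∷ v) (a≢m ∷ v≢m) rewrite ≢⇒≡ᵇ≡false a m a≢m = cong (a ∷_) (remove-∉ m v v≢m)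

remove-insert : ∀ m u v → All (_≢ m) u → All (_≢ m) v → remove m (u ++ m ∷ v) ≡ u ++ v
remove-insert m []      v []          v≢m rewrite ≡ᵇ-refl m = remove-∉ m v v≢m
remove-insert m (a ∷ u) v (a≢m ∷ u≢m) v≢m rewrite ≢⇒≡ᵇ≡false a m a≢m = cong (a ∷_) (remove-insert m u v u≢m v≢m)

All-<-∉ : ∀ {n l} → All (_< suc n) l → n ∉ l → All (_< n) l
All-<-∉ {n} {l} l<1+n n∉l = All.tabulate λ {x} x∈l →
  ≤∧≢⇒< (s≤s⁻¹ (All.lookup l<1+n x∈l)) (λ x≡n → n∉l (subst (_∈ l) x≡n x∈l))

Unique-length-≤ : ∀ n l → Unique l → All (_< n) l → length l ≤ n
Unique-length-≤ zero    []      _ _          = z≤n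
Unique-length-≤ zero    (x ∷ l) _ (() ∷ _)
Unique-length-≤ (suc n) l       u l<1+n with n ∈? l
... | no n∉l = m≤n⇒m≤1+n (Unique-length-≤ n l u (All-<-∉ l<1+n n∉l))
... | yes n∈l with ∈-∃++ n∈l
... | p , q , refl with Unique-remove p u | All-remove p l<1+n
... | u′ , n∉ | _ , pq<1+n =
  subst (_≤ suc n) (sym (length-++-sucʳ p n q))
    (s≤s (Unique-length-≤ n (p ++ q) u′ (All-<-∉ pq<1+n λ n∈pq → All.lookup n∉ n∈pq refl)))

∈-max : ∀ n l → length l ≡ suc n → Unique l → All (_< suc n) l → n ∈ l
∈-max n l |l|≡1+n u l<1+n with n ∈? l
... | yes n∈l = n∈l
... | no  n∉l = ⊥-elim (<-irrefl refl (subst (_≤ n) |l|≡1+n (Unique-length-≤ n l u (All-<-∉ l<1+n n∉l))))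

filterᵇ-↭ : ∀ {A : Set} (p : A → Bool) {xs ys} → xs ↭ ys → filterᵇ p xs ↭ filterᵇ p ys
filterᵇ-↭ {A} p xs↭ys = ↭ₛ⇒↭ (↭ₛ.filter⁺ (setoid A) (T? ∘ p) (λ { refl px → px }) (↭⇒↭ₛ xs↭ys))

length-filterᵇ-++ : ∀ {A : Set} (p : A → Bool) xs ys →
  length (filterᵇ p (xs ++ ys)) ≡ length (filterᵇ p xs) + length (filterᵇ p ys)
length-filterᵇ-++ p xs ys = trans (cong length (filter-++ (T? ∘ p) xs ys)) (length-++ (filterᵇ p xs))

occurrences : ℕ → List ℕ → ℕ
occurrences k xs = length (filterᵇ (_≡ᵇ k) xs)

occurrences-↭ : ∀ k {xs ys} → xs ↭ ys → occurrences k xs ≡ occurrences k ys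
occurrences-↭ k xs↭ys = ↭-length (filterᵇ-↭ (_≡ᵇ k) xs↭ys)

occurrences-replicate : ∀ k a x → occurrences k (replicate a x) ≡ (if x ≡ᵇ k then a else 0)
occurrences-replicate k zero    x with x ≡ᵇ k
... | true  = refl
... | false = refl
occurrences-replicate k (suc a) x with x ≡ᵇ k | occurrences-replicate k a x
... | true  | ih = cong suc ih
... | false | ih = ih

length-filterᵇ-map : ∀ {A : Set} (h : A → ℕ) k xs →
  length (filterᵇ (λ x → h x ≡ᵇ k) xs) ≡ occurrences k (map h xs)
length-filterᵇ-map h k []       = refl
length-filterᵇ-map h k (x ∷ xs) with h x ≡ᵇ k
... | true  = cong suc (length-filterᵇ-map h k xs)
... | false = length-filterᵇ-map h k xs

sumMap : ∀ {A : Set} → (A → ℕ) → List A → ℕ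
sumMap f []       = 0
sumMap f (x ∷ xs) = f x + sumMap f xs

sumMap-cong : ∀ {A : Set} {f g : A → ℕ} xs → (∀ {x} → x ∈ xs → f x ≡ g x) → sumMap f xs ≡ sumMap g xs
sumMap-cong []       f≗g = refl
sumMap-cong (x ∷ xs) f≗g = cong₂ _+_ (f≗g (here refl)) (sumMap-cong xs (f≗g ∘ there))

sumMap-+ : ∀ {A : Set} (f g : A → ℕ) xs → sumMap (λ x → f x + g x) xs ≡ sumMap f xs + sumMap g xs
sumMap-+ f g []       = refl
sumMap-+ f g (x ∷ xs) rewrite sumMap-+ f g xs = interchange (f x) (g x) (sumMap f xs) (sumMap g xs)
  where
  interchange : ∀ a b c d → a + b + (c + d) ≡ a + c + (b + d)
  interchange = solve-∀

sumMap-const : ∀ {A : Set} c (xs : List A) → sumMap (λ _ → c) xs ≡ c * length xs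
sumMap-const c []       = sym (*-zeroʳ c)
sumMap-const c (x ∷ xs) = trans (cong (_+_ c) (sumMap-const c xs)) (sym (*-suc c (length xs)))

sumMap-indicator : ∀ {A : Set} (h : A → ℕ) (c : ℕ → ℕ) k xs →
  sumMap (λ x → if h x ≡ᵇ k then c (h x) else 0) xs ≡ c k * length (filterᵇ (λ x → h x ≡ᵇ k) xs)
sumMap-indicator h c k []       = sym (*-zeroʳ (c k))
sumMap-indicator h c k (x ∷ xs) with h x ≡ᵇ k in eq
... | true rewrite ≡ᵇ≡true⇒≡ (h x) k eq =
  trans (cong (_+_ (c k)) (sumMap-indicator h c k xs)) (sym (*-suc (c k) _))
... | false = sumMap-indicator h c k xs

length-filterᵇ-concatMap : ∀ {A B : Set} (p : B → Bool) (f : A → List B) xs →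
  length (filterᵇ p (concatMap f xs)) ≡ sumMap (λ x → length (filterᵇ p (f x))) xs
length-filterᵇ-concatMap p f []       = refl
length-filterᵇ-concatMap p f (x ∷ xs) =
  trans (length-filterᵇ-++ p (f x) (concatMap f xs)) (cong (_+_ _) (length-filterᵇ-concatMap p f xs))

length-concatMap : ∀ {A B : Set} (f : A → List B) xs → length (concatMap f xs) ≡ sumMap (length ∘ f) xs
length-concatMap f []       = refl
length-concatMap f (x ∷ xs) = trans (length-++ (f x)) (cong (_+_ (length (f x))) (length-concatMap f xs))

at : List ℕ → ℕ → ℕ
at []      _       = 0
at (x ∷ l) zero    = x
at (x ∷ l) (suc i) = at l i

at-∈ : ∀ l y → y < length l → at l y ∈ l
at-∈ (a ∷ l) zero    _         = here refl
at-∈ (a ∷ l) (suc y) (s≤s y<l) = there (at-∈ l y y<l)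

∈⇒at : ∀ l {z} → z ∈ l → ∃ λ y → y < length l × at l y ≡ z
∈⇒at (a ∷ l) (here refl) = 0 , s≤s z≤n , refl
∈⇒at (a ∷ l) (there z∈) with ∈⇒at l z∈
... | y , y<l , refl = suc y , s≤s y<l , refl

Distinct : List ℕ → Set
Distinct l = ∀ x y → x < y → y < length l → at l x ≢ at l y

Unique⇒Distinct : ∀ l → Unique l → Distinct l
Unique⇒Distinct (a ∷ l) (a∉ ∷ _) zero    (suc y) _         (s≤s y<l) = All.lookup a∉ (at-∈ l y y<l)
Unique⇒Distinct (a ∷ l) (_ ∷ u)  (suc x) (suc y) (s≤s x<y) (s≤s y<l) = Unique⇒Distinct l u x y x<y y<l

Distinct⇒at-injective : ∀ {l} → Distinct l → ∀ {x y} → x < length l → y < length l → at l x ≡ at l y → x ≡ y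
Distinct⇒at-injective distinct {x} {y} x<l y<l eq with <-cmp x y
... | tri< x<y _ _ = ⊥-elim (distinct x y x<y y<l eq)
... | tri≈ _ x≡y _ = x≡y
... | tri> _ _ y<x = ⊥-elim (distinct y x y<x x<l (sym eq))

Distinct⇒Unique : ∀ l → Distinct l → Unique l
Distinct⇒Unique []      _        = []
Distinct⇒Unique (a ∷ l) distinct =
  All.tabulate a≢ ∷ Distinct⇒Unique l λ x y x<y y<l → distinct (suc x) (suc y) (s≤s x<y) (s≤s y<l)
  where
  a≢ : ∀ {z} → z ∈ l → a ≢ z
  a≢ z∈ with ∈⇒at l z∈
  ... | y , y<l , refl = distinct 0 (suc y) (s≤s z≤n) (s≤s y<l)

length-take-< : ∀ j (l : List ℕ) → j < length l → length (take j l) ≡ j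
length-take-< j l j<l = trans (length-take j l) (m≤n⇒m⊓n≡m (<⇒≤ j<l))

at-take : ∀ j l x → x < j → at (take j l) x ≡ at l x
at-take (suc j) []      x       _         = refl
at-take (suc j) (a ∷ l) zero    _         = refl
at-take (suc j) (a ∷ l) (suc x) (s≤s x<j) = at-take j l x x<j

-- Words avoiding the pattern

smallerCount : ℕ → List ℕ → ℕ
smallerCount b xs = length (filterᵇ (_<ᵇ b) xs)

-- `pre` holds the entries already read, in reverse order.
avoidsAfter : List ℕ → List ℕ → Bool
avoidsAfter pre []      = true
avoidsAfter pre (a ∷ w) = not (smallerCount a pre ≡ᵇ 1) ∧ avoidsAfter (a ∷ pre) w

smallerCount-∷ : ∀ b a xs → smallerCount b (a ∷ xs) ≡ (if a <ᵇ b then 1 else 0) + smallerCount b xs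
smallerCount-∷ b a xs with a <ᵇ b
... | true  = refl
... | false = refl

smallerCount-move : ∀ b a xs pre →
  smallerCount b (a ∷ xs) + smallerCount b pre ≡ smallerCount b xs + smallerCount b (a ∷ pre)
smallerCount-move b a xs pre rewrite smallerCount-∷ b a xs | smallerCount-∷ b a pre =
  rearrange (if a <ᵇ b then 1 else 0) (smallerCount b xs) (smallerCount b pre)
  where
  rearrange : ∀ d x p → (d + x) + p ≡ x + (d + p)
  rearrange = solve-∀

avoidsAfter-false⇒ : ∀ pre l → avoidsAfter pre l ≡ false →
  ∃ λ j → j < length l × smallerCount (at l j) (take j l) + smallerCount (at l j) pre ≡ 1
avoidsAfter-false⇒ pre (a ∷ l) e with smallerCount a pre ≡ᵇ 1 in count≡1
... | true  = 0 , s≤s z≤n , ≡ᵇ≡true⇒≡ _ 1 count≡1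
... | false with avoidsAfter-false⇒ (a ∷ pre) l e
... | j , j<l , count = suc j , s≤s j<l , trans (smallerCount-move (at l j) a (take j l) pre) count

⇒avoidsAfter-false : ∀ pre l j → j < length l →
  smallerCount (at l j) (take j l) + smallerCount (at l j) pre ≡ 1 → avoidsAfter pre l ≡ false
⇒avoidsAfter-false pre (a ∷ l) zero    _         count rewrite count = refl
⇒avoidsAfter-false pre (a ∷ l) (suc j) (s≤s j<l) count
  rewrite ⇒avoidsAfter-false (a ∷ pre) l j j<l (trans (sym (smallerCount-move (at l j) a (take j l) pre)) count) =
  ∧-zeroʳ _

NoneBelow : ℕ → List ℕ → Set
NoneBelow b xs = ∀ x → x < length xs → at xs x < b → ⊥

SoleBelow : ℕ → List ℕ → ℕ → Set
SoleBelow b xs i = i < length xs × at xs i < b × (∀ x → x < length xs → at xs x < b → x ≡ i)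

smallerCount≡0⇒ : ∀ b xs → smallerCount b xs ≡ 0 → NoneBelow b xs
smallerCount≡0⇒ b (a ∷ xs) count≡0 x x<l below with a <ᵇ b in a<ᵇb
smallerCount≡0⇒ b (a ∷ xs) ()      x       x<l       below | true
smallerCount≡0⇒ b (a ∷ xs) count≡0 zero    _         below | false = <⇒≱ below (<ᵇ≡false⇒≥ a b a<ᵇb)
smallerCount≡0⇒ b (a ∷ xs) count≡0 (suc x) (s≤s x<l) below | false = smallerCount≡0⇒ b xs count≡0 x x<l below

⇒smallerCount≡0 : ∀ b xs → NoneBelow b xs → smallerCount b xs ≡ 0
⇒smallerCount≡0 b []       _    = refl
⇒smallerCount≡0 b (a ∷ xs) none with a <ᵇ b in a<ᵇb
... | true  = ⊥-elim (none 0 (s≤s z≤n) (<ᵇ≡true⇒< a<ᵇb))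
... | false = ⇒smallerCount≡0 b xs λ x x<l → none (suc x) (s≤s x<l)

smallerCount≡1⇒ : ∀ b xs → smallerCount b xs ≡ 1 → ∃ (SoleBelow b xs)
smallerCount≡1⇒ b (a ∷ xs) count≡1 with a <ᵇ b in a<ᵇb
... | true  = 0 , s≤s z≤n , <ᵇ≡true⇒< a<ᵇb , only-head
  where
  only-head : ∀ x → x < length (a ∷ xs) → at (a ∷ xs) x < b → x ≡ 0
  only-head zero    _         _     = refl
  only-head (suc x) (s≤s x<l) below = ⊥-elim (smallerCount≡0⇒ b xs (suc-injective count≡1) x x<l below)
... | false with smallerCount≡1⇒ b xs count≡1
... | i , i<l , below , sole = suc i , s≤s i<l , below , sole′
  where
  sole′ : ∀ x → x < length (a ∷ xs) → at (a ∷ xs) x < b → x ≡ suc i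
  sole′ zero    _          a<b = ⊥-elim (<⇒≱ a<b (<ᵇ≡false⇒≥ a b a<ᵇb))
  sole′ (suc x) (s≤s x<l) below′ = cong suc (sole x x<l below′)

⇒smallerCount≡1 : ∀ b xs i → SoleBelow b xs i → smallerCount b xs ≡ 1
⇒smallerCount≡1 b (a ∷ xs) zero    (_ , a<b , sole) rewrite <⇒<ᵇ≡true a<b =
  cong suc (⇒smallerCount≡0 b xs λ x x<l below → case sole (suc x) (s≤s x<l) below of λ ())
⇒smallerCount≡1 b (a ∷ xs) (suc i) (s≤s i<l , below , sole) with a <ᵇ b in a<ᵇb
... | true  = case sole 0 (s≤s z≤n) (<ᵇ≡true⇒< a<ᵇb) of λ ()
... | false = ⇒smallerCount≡1 b xs i (i<l , below , λ x x<l below′ → suc-injective (sole (suc x) (s≤s x<l) below′))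

IsOccurrence : List ℕ → ℕ → ℕ → Set
IsOccurrence l i j = i < j × j < length l × at l i < at l j × (∀ x → x < j → at l x < at l j → x ≡ i)

avoidsAfter-false⇒occurrence : ∀ l → avoidsAfter [] l ≡ false → ∃₂ (IsOccurrence l)
avoidsAfter-false⇒occurrence l avoids≡false with avoidsAfter-false⇒ [] l avoids≡false
... | j , j<l , count with smallerCount≡1⇒ (at l j) (take j l) (trans (sym (+-identityʳ _)) count)
... | i , i<|take| , below , sole =
  i , j , i<j , j<l , subst (_< at l j) (at-take j l i i<j) below ,
  λ x x<j below′ → sole x (subst (x <_) (sym |take|≡j) x<j) (subst (_< at l j) (sym (at-take j l x x<j)) below′)
  where
  |take|≡j : length (take j l) ≡ j
  |take|≡j = length-take-< j l j<l
  i<j : i < j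
  i<j = subst (i <_) |take|≡j i<|take|

occurrence⇒avoidsAfter-false : ∀ l i j → IsOccurrence l i j → avoidsAfter [] l ≡ false
occurrence⇒avoidsAfter-false l i j (i<j , j<l , below , sole) =
  ⇒avoidsAfter-false [] l j j<l (trans (+-identityʳ _) (⇒smallerCount≡1 (at l j) (take j l) i
    (subst (i <_) (sym |take|≡j) i<j , subst (_< at l j) (sym (at-take j l i i<j)) below ,
     λ x x<|take| below′ → let x<j = subst (x <_) |take|≡j x<|take| in
       sole x x<j (subst (_< at l j) (at-take j l x x<j) below′))))
  where
  |take|≡j : length (take j l) ≡ j
  |take|≡j = length-take-< j l j<l

smallerCount-all< : ∀ m pre → All (_< m) pre → smallerCount m pre ≡ length pre
smallerCount-all< m []        []         = refl
smallerCount-all< m (a ∷ pre) (a<m ∷ ps) rewrite <⇒<ᵇ≡true a<m = cong suc (smallerCount-all< m pre ps)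

SameCountsBelow : ℕ → List ℕ → List ℕ → Set
SameCountsBelow m p q = ∀ b → b < m → smallerCount b p ≡ smallerCount b q

SameCountsBelow-∷ : ∀ {m p q} a → SameCountsBelow m p q → SameCountsBelow m (a ∷ p) (a ∷ q)
SameCountsBelow-∷ a same b b<m with a <ᵇ b
... | true  = cong suc (same b b<m)
... | false = same b b<m

SameCountsBelow-max : ∀ m pre → SameCountsBelow m (m ∷ pre) pre
SameCountsBelow-max m pre b b<m rewrite ≤⇒>ᵇ≡false {m} {b} (<⇒≤ b<m) = refl

avoidsAfter-cong : ∀ {m p q} w → All (_< m) w → SameCountsBelow m p q → avoidsAfter p w ≡ avoidsAfter q w
avoidsAfter-cong []      _           _    = refl
avoidsAfter-cong (a ∷ w) (a<m ∷ w<m) same =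
  cong₂ (λ x y → not (x ≡ᵇ 1) ∧ y) (same a a<m) (avoidsAfter-cong w w<m (SameCountsBelow-∷ a same))

-- Inserting a new maximum m only adds the test at m itself, where all
-- |u| + |pre| earlier entries are smaller.
avoidsAfter-insert-max : ∀ m pre u v → All (_< m) pre → All (_< m) u → All (_< m) v →
  avoidsAfter pre (u ++ m ∷ v) ≡ not (length u + length pre ≡ᵇ 1) ∧ avoidsAfter pre (u ++ v)
avoidsAfter-insert-max m pre []      v pre<m []         v<m rewrite smallerCount-all< m pre pre<m =
  cong (not (length pre ≡ᵇ 1) ∧_) (avoidsAfter-cong v v<m (SameCountsBelow-max m pre))
avoidsAfter-insert-max m pre (a ∷ u) v pre<m (a<m ∷ u<m) v<m
  rewrite avoidsAfter-insert-max m (a ∷ pre) u v (a<m ∷ pre<m) u<m v<m | +-suc (length u) (length pre) =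
  ∧-left-comm (not (smallerCount a pre ≡ᵇ 1)) (not (length u + length pre ≡ᵇ 0)) (avoidsAfter (a ∷ pre) (u ++ v))
  where
  ∧-left-comm : ∀ x y z → x ∧ (y ∧ z) ≡ y ∧ (x ∧ z)
  ∧-left-comm true  y z = refl
  ∧-left-comm false y z = sym (∧-comm y false)

insert-max-avoids : ∀ m u v → All (_< m) (u ++ v) → length u ≢ 1 →
  avoidsAfter [] (u ++ v) ≡ true → avoidsAfter [] (u ++ m ∷ v) ≡ true
insert-max-avoids m u v uv<m |u|≢1 avoids
  rewrite avoidsAfter-insert-max m [] u v [] (All.++⁻ˡ u uv<m) (All.++⁻ʳ u uv<m)
        | +-identityʳ (length u) | ≢⇒≡ᵇ≡false (length u) 1 |u|≢1 = avoids

insert-max-avoids⁻ : ∀ m u v → All (_< m) (u ++ v) →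
  avoidsAfter [] (u ++ m ∷ v) ≡ true → length u ≢ 1 × avoidsAfter [] (u ++ v) ≡ true
insert-max-avoids⁻ m u v uv<m avoids = |u|≢1 , proj₂ both
  where
  both : not (length u + 0 ≡ᵇ 1) ≡ true × avoidsAfter [] (u ++ v) ≡ true
  both = ∧≡true⇒ (trans (sym (avoidsAfter-insert-max m [] u v [] (All.++⁻ˡ u uv<m) (All.++⁻ʳ u uv<m))) avoids)
  |u|≢1 : length u ≢ 1
  |u|≢1 |u|≡1 = case subst (λ k → not (k ≡ᵇ 1) ≡ true) (trans (+-identityʳ (length u)) |u|≡1) (proj₁ both) of λ ()

insertions : ℕ → List ℕ → List (List ℕ)
insertions m []      = (m ∷ []) ∷ []
insertions m (a ∷ w) = (m ∷ a ∷ w) ∷ map (a ∷_) (insertions m w)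


-- all insertions of m except the one right after the first entry
admissibleInsertions : ℕ → List ℕ → List (List ℕ)
admissibleInsertions m w = dropSecond (insertions m w)

avoiders : ℕ → List (List ℕ)
avoiders zero    = [] ∷ []
avoiders (suc n) = concatMap (admissibleInsertions n) (avoiders n)

IsAvoider : ℕ → List ℕ → Set
IsAvoider n w = length w ≡ n × All (_< n) w × Unique w × avoidsAfter [] w ≡ true

∈-insertions⁻ : ∀ m w {x} → x ∈ insertions m w → ∃₂ λ u v → w ≡ u ++ v × x ≡ u ++ m ∷ v
∈-insertions⁻ m []      (here refl) = [] , [] , refl , refl
∈-insertions⁻ m (a ∷ w) (here refl) = [] , a ∷ w , refl , refl
∈-insertions⁻ m (a ∷ w) (there x∈) with ∈-map⁻ (a ∷_) x∈
... | y , y∈ , refl with ∈-insertions⁻ m w y∈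
... | u , v , refl , refl = a ∷ u , v , refl , refl

∈-insertions⁺ : ∀ m u v → u ++ m ∷ v ∈ insertions m (u ++ v)
∈-insertions⁺ m []      []      = here refl
∈-insertions⁺ m []      (a ∷ v) = here refl
∈-insertions⁺ m (a ∷ u) v       = there (∈-map⁺ (a ∷_) (∈-insertions⁺ m u v))

∈-admissibleInsertions⁻ : ∀ m w {x} → x ∈ admissibleInsertions m w →
  ∃₂ λ u v → w ≡ u ++ v × x ≡ u ++ m ∷ v × length u ≢ 1
∈-admissibleInsertions⁻ m []          (here refl) = [] , [] , refl , refl , λ ()
∈-admissibleInsertions⁻ m (a ∷ [])    (here refl) = [] , a ∷ [] , refl , refl , λ ()
∈-admissibleInsertions⁻ m (a ∷ b ∷ w) (here refl) = [] , a ∷ b ∷ w , refl , refl , λ ()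
∈-admissibleInsertions⁻ m (a ∷ b ∷ w) (there x∈) with ∈-map⁻ (a ∷_) x∈
... | y , y∈ , refl with ∈-map⁻ (b ∷_) y∈
... | z , z∈ , refl with ∈-insertions⁻ m w z∈
... | u , v , refl , refl = a ∷ b ∷ u , v , refl , refl , λ ()

∈-admissibleInsertions⁺ : ∀ m u v → length u ≢ 1 → u ++ m ∷ v ∈ admissibleInsertions m (u ++ v)
∈-admissibleInsertions⁺ m []          []          _  = here refl
∈-admissibleInsertions⁺ m []          (a ∷ [])    _  = here refl
∈-admissibleInsertions⁺ m []          (a ∷ b ∷ v) _  = here refl
∈-admissibleInsertions⁺ m (a ∷ [])    v           ≢1 = ⊥-elim (≢1 refl)
∈-admissibleInsertions⁺ m (a ∷ b ∷ u) v           _  = there (∈-map⁺ (a ∷_) (∈-map⁺ (b ∷_) (∈-insertions⁺ m u v)))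

Unique-insertions : ∀ m w → All (m ≢_) w → Unique (insertions m w)
Unique-insertions m []      _          = [] ∷ []
Unique-insertions m (a ∷ w) (m≢a ∷ m∉) =
  All.map⁺ (All.universal (λ _ eq → m≢a (∷-injectiveˡ eq)) _) ∷ Unique.map⁺ ∷-injectiveʳ (Unique-insertions m w m∉)

length-insertions : ∀ m w → length (insertions m w) ≡ suc (length w)
length-insertions m []      = refl
length-insertions m (a ∷ w) = cong suc (trans (length-map (a ∷_) (insertions m w)) (length-insertions m w))

length-admissibleInsertions : ∀ m a w → length (admissibleInsertions m (a ∷ w)) ≡ suc (length w)
length-admissibleInsertions m a []      = refl
length-admissibleInsertions m a (b ∷ w) =
  cong suc (trans (length-map (a ∷_) (map (b ∷_) (insertions m w)))
                 (trans (length-map (b ∷_) (insertions m w)) (length-insertions m w)))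

avoiders⇒IsAvoider : ∀ n {w} → w ∈ avoiders n → IsAvoider n w
avoiders⇒IsAvoider zero    (here refl) = refl , [] , [] , refl
avoiders⇒IsAvoider (suc n) w∈ with ∈-concatMap⁻ (admissibleInsertions n) (avoiders n) w∈
... | σ , σ∈ , w∈σ with ∈-admissibleInsertions⁻ n σ w∈σ | avoiders⇒IsAvoider n σ∈
... | u , v , refl , refl , |u|≢1 | |σ|≡n , σ<n , σ-unique , σ-avoids =
  trans (length-++-sucʳ u n v) (cong suc |σ|≡n) ,
  All-insert u (All.map m≤n⇒m≤1+n σ<n) ≤-refl ,
  Unique-insert u σ-unique (All.map >⇒≢ σ<n) ,
  insert-max-avoids n u v σ<n |u|≢1 σ-avoids

IsAvoider⇒avoiders : ∀ n {w} → IsAvoider n w → w ∈ avoiders n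
IsAvoider⇒avoiders zero    {[]} _ = here refl
IsAvoider⇒avoiders (suc n) {w} (|w|≡1+n , w<1+n , w-unique , w-avoids) with ∈-∃++ (∈-max n w |w|≡1+n w-unique w<1+n)
... | u , v , refl =
  ∈-concatMap⁺ (admissibleInsertions n)
    (IsAvoider⇒avoiders n (|uv|≡n , uv<n , proj₁ uv-unique , proj₂ shape))
    (∈-admissibleInsertions⁺ n u v (proj₁ shape))
  where
  uv-unique : Unique (u ++ v) × All (n ≢_) (u ++ v)
  uv-unique = Unique-remove u w-unique
  uv<n : All (_< n) (u ++ v)
  uv<n = All-<-∉ (proj₂ (All-remove u w<1+n)) (λ n∈ → All.lookup (proj₂ uv-unique) n∈ refl)
  shape : length u ≢ 1 × avoidsAfter [] (u ++ v) ≡ true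
  shape = insert-max-avoids⁻ n u v uv<n w-avoids
  |uv|≡n : length (u ++ v) ≡ n
  |uv|≡n = suc-injective (trans (sym (length-++-sucʳ u n v)) |w|≡1+n)

Unique-avoiders : ∀ n → Unique (avoiders n)
Unique-avoiders zero    = [] ∷ []
Unique-avoiders (suc n) = concatMap-unique (admissibleInsertions n) (Unique-avoiders n)
  (λ σ∈ → Unique-dropSecond (Unique-insertions n _ (All.map >⇒≢ (proj₁ (proj₂ (avoiders⇒IsAvoider n σ∈))))))
  (λ σ∈ σ′∈ w∈ w∈′ → trans (sym (remove-max σ∈ w∈)) (remove-max σ′∈ w∈′))
  where
  remove-max : ∀ {σ w} → σ ∈ avoiders n → w ∈ admissibleInsertions n σ → remove n w ≡ σ
  remove-max {σ} σ∈ w∈ with ∈-admissibleInsertions⁻ n σ w∈ | avoiders⇒IsAvoider n σ∈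
  ... | u , v , refl , refl , _ | _ , σ<n , _ =
    remove-insert n u v (All.map <⇒≢ (All.++⁻ˡ u σ<n)) (All.map <⇒≢ (All.++⁻ʳ u σ<n))

length-avoiders : ∀ n → length (avoiders (suc n)) ≡ n !
length-avoiders zero    = refl
length-avoiders (suc n) = begin
  length (avoiders (suc (suc n)))
    ≡⟨ length-concatMap (admissibleInsertions (suc n)) (avoiders (suc n)) ⟩
  sumMap (length ∘ admissibleInsertions (suc n)) (avoiders (suc n))
    ≡⟨ sumMap-cong (avoiders (suc n)) (λ σ∈ → choices (avoiders⇒IsAvoider (suc n) σ∈)) ⟩
  sumMap (λ _ → suc n) (avoiders (suc n))
    ≡⟨ sumMap-const (suc n) (avoiders (suc n)) ⟩
  suc n * length (avoiders (suc n))
    ≡⟨ cong (suc n *_) (length-avoiders n) ⟩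
  suc n * n ! ∎
  where
  open ≡-Reasoning
  choices : ∀ {σ} → IsAvoider (suc n) σ → length (admissibleInsertions (suc n) σ) ≡ suc n
  choices {a ∷ r} (|σ|≡1+n , _) = trans (length-admissibleInsertions (suc n) a r) |σ|≡1+n

-- Descents of the avoiders

desL-≤ : ∀ a r → desL (a ∷ r) ≤ length r
desL-≤ a []      = z≤n
desL-≤ a (b ∷ r) with b <ᵇ a
... | true  = s≤s (desL-≤ b r)
... | false = m≤n⇒m≤1+n (desL-≤ b r)

spread : ℕ → ℕ → ℕ → List ℕ
spread a x b = replicate a x ++ replicate b (suc x)

map-suc-spread : ∀ a x b → map suc (spread a x b) ≡ spread a (suc x) b
map-suc-spread a x b = trans (map-++ suc (replicate a x) _) (cong₂ _++_ (map-replicate suc a x) (map-replicate suc b (suc x)))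

spread-shift : ∀ a x b → suc x ∷ spread a x b ↭ spread a x (suc b)
spread-shift a x b = ↭-sym (shift (suc x) (replicate a x) (replicate b (suc x)))

map-suc-↭-spread : ∀ {xs} a x b → xs ↭ spread a x b → map suc xs ↭ spread a (suc x) b
map-suc-↭-spread a x b xs↭ = subst (_ ↭_) (map-suc-spread a x b) (↭.map⁺ suc xs↭)

occurrences-spread : ∀ k a x b →
  occurrences k (spread a x b) ≡ (if x ≡ᵇ k then a else 0) + (if suc x ≡ᵇ k then b else 0)
occurrences-spread k a x b = trans (length-filterᵇ-++ (_≡ᵇ k) (replicate a x) _)
  (cong₂ _+_ (occurrences-replicate k a x) (occurrences-replicate k b (suc x)))

insertions-des : ∀ m b r → All (_< m) (b ∷ r) →
  map (λ y → desL (b ∷ y)) (insertions m r) ↭ spread (suc (desL (b ∷ r))) (desL (b ∷ r)) (length r ∸ desL (b ∷ r))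
insertions-des m b []      (b<m ∷ []) rewrite ≤⇒>ᵇ≡false (<⇒≤ b<m) = ↭-refl
insertions-des m b (c ∷ r) (b<m ∷ c<m ∷ r<m)
  rewrite sym (map-∘ {g = λ y → desL (b ∷ y)} {f = c ∷_} (insertions m r))
        | ≤⇒>ᵇ≡false (<⇒≤ b<m) | <⇒<ᵇ≡true c<m
  with c <ᵇ b | insertions-des m c r (c<m ∷ r<m)
... | true  | ih =
  ↭-prep _ (subst (_↭ _) (sym (map-∘ {g = suc} {f = λ y → desL (c ∷ y)} (insertions m r)))
                  (map-suc-↭-spread (suc (desL (c ∷ r))) (desL (c ∷ r)) (length r ∸ desL (c ∷ r)) ih))
... | false | ih rewrite +-∸-assoc 1 (desL-≤ c r) =
  ↭-trans (↭-prep _ ih) (spread-shift (suc (desL (c ∷ r))) (desL (c ∷ r)) (length r ∸ desL (c ∷ r)))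

admissibleInsertions-des : ∀ m a b r → All (_< m) (a ∷ b ∷ r) → b < a →
  let d = desL (a ∷ b ∷ r) in
  map desL (admissibleInsertions m (a ∷ b ∷ r)) ↭ spread d d (length (a ∷ b ∷ r) ∸ d)
admissibleInsertions-des m a b r (a<m ∷ br<m) b<a
  rewrite sym (map-∘ {g = desL} {f = a ∷_} (map (b ∷_) (insertions m r)))
        | sym (map-∘ {g = λ y → desL (a ∷ y)} {f = b ∷_} (insertions m r))
        | <⇒<ᵇ≡true a<m | <⇒<ᵇ≡true b<a | +-∸-assoc 1 (desL-≤ b r) =
  ↭-trans (↭-prep _ (subst (_↭ spread (suc e) (suc e) (length r ∸ e)) (sym (map-∘ (insertions m r)))
                            (map-suc-↭-spread (suc e) e (length r ∸ e) (insertions-des m b r br<m))))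
          (spread-shift (suc e) (suc e) (length r ∸ e))
  where
  e : ℕ
  e = desL (b ∷ r)

-- among the n admissible insertions into an avoider with d descents, the number with k descents
insertionDesCount : ℕ → ℕ → ℕ → ℕ
insertionDesCount n d k = (if d ≡ᵇ k then d else 0) + (if suc d ≡ᵇ k then n ∸ d else 0)

desCount : ℕ → ℕ → ℕ
desCount n k = length (filterᵇ (λ w → desL w ≡ᵇ k) (avoiders n))

-- the second entry has exactly one smaller entry to its left unless it is a descent
avoider-starts-with-descent : ∀ n {σ} → IsAvoider (suc (suc n)) σ → ∃₂ λ a b → ∃ λ r → σ ≡ a ∷ b ∷ r × b < a
avoider-starts-with-descent n {a ∷ b ∷ r} (_ , _ , (a∉ ∷ _) , avoids) with a <ᵇ b in a<ᵇb
... | true  = case avoids of λ ()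
... | false = a , b , r , refl , ≤∧≢⇒< (<ᵇ≡false⇒≥ a b a<ᵇb) (λ b≡a → All.head a∉ (sym b≡a))

admissibleInsertions-occurrences : ∀ n {σ} k → IsAvoider (suc (suc n)) σ →
  occurrences k (map desL (admissibleInsertions (suc (suc n)) σ)) ≡ insertionDesCount (suc (suc n)) (desL σ) k
admissibleInsertions-occurrences n k σ-avoider with avoider-starts-with-descent n σ-avoider
... | a , b , r , refl , b<a = begin
  occurrences k (map desL (admissibleInsertions (suc (suc n)) (a ∷ b ∷ r)))
    ≡⟨ occurrences-↭ k (admissibleInsertions-des _ a b r (proj₁ (proj₂ σ-avoider)) b<a) ⟩
  occurrences k (spread d d (length (a ∷ b ∷ r) ∸ d))
    ≡⟨ occurrences-spread k d d (length (a ∷ b ∷ r) ∸ d) ⟩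
  insertionDesCount (length (a ∷ b ∷ r)) d k
    ≡⟨ cong (λ ℓ → insertionDesCount ℓ d k) (proj₁ σ-avoider) ⟩
  insertionDesCount (suc (suc n)) d k ∎
  where
  open ≡-Reasoning
  d : ℕ
  d = desL (a ∷ b ∷ r)

desCount-step : ∀ n k →
  desCount (suc (suc (suc n))) k ≡ sumMap (λ σ → insertionDesCount (suc (suc n)) (desL σ) k) (avoiders (suc (suc n)))
desCount-step n k = trans (length-filterᵇ-concatMap _ (admissibleInsertions (suc (suc n))) (avoiders (suc (suc n))))
  (sumMap-cong (avoiders (suc (suc n))) λ {σ} σ∈ →
    trans (length-filterᵇ-map desL k (admissibleInsertions (suc (suc n)) σ))
          (admissibleInsertions-occurrences n k (avoiders⇒IsAvoider _ σ∈)))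

desCount-zero : ∀ n → desCount (suc (suc (suc n))) 0 ≡ 0
desCount-zero n = trans (desCount-step n 0) (trans (sumMap-+ _ _ (avoiders (suc (suc n))))
  (cong₂ _+_ (sumMap-indicator desL (λ d → d) 0 (avoiders (suc (suc n)))) (sumMap-const 0 (avoiders (suc (suc n))))))

desCount-suc : ∀ n k → desCount (suc (suc (suc n))) (suc k)
  ≡ suc k * desCount (suc (suc n)) (suc k) + (suc (suc n) ∸ k) * desCount (suc (suc n)) k
desCount-suc n k = trans (desCount-step n (suc k)) (trans (sumMap-+ _ _ (avoiders (suc (suc n))))
  (cong₂ _+_ (sumMap-indicator desL (λ d → d) (suc k) (avoiders (suc (suc n))))
             (sumMap-indicator desL (λ d → suc (suc n) ∸ d) k (avoiders (suc (suc n))))))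

desCount-vanishes : ∀ n k → suc n ≤ k → desCount (suc n) k ≡ 0
desCount-vanishes n k n<k =
  cong length (filter-none (T? ∘ (λ w → desL w ≡ᵇ k)) (All.tabulate λ w∈ → too-many (avoiders⇒IsAvoider (suc n) w∈)))
  where
  too-many : ∀ {w} → IsAvoider (suc n) w → ¬ T (desL w ≡ᵇ k)
  too-many {a ∷ r} (|w|≡1+n , _) d≡k =
    <-irrefl (≡ᵇ⇒≡ _ k d≡k) (≤-trans (s≤s (subst (desL (a ∷ r) ≤_) (suc-injective |w|≡1+n) (desL-≤ a r))) n<k)

-- Permutations as words

word : ∀ {n k} → Vec (Fin n) k → List ℕ
word v = toList (Vec.map toℕ v)

at-word : ∀ {n k} (v : Vec (Fin n) k) i → at (word v) (toℕ i) ≡ toℕ (lookup v i)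
at-word (a ∷ v) Fin.zero    = refl
at-word (a ∷ v) (Fin.suc i) = at-word v i

at-word-fromℕ< : ∀ {n k} (v : Vec (Fin n) k) {x} (x<k : x < k) → at (word v) x ≡ toℕ (lookup v (fromℕ< x<k))
at-word-fromℕ< v x<k = trans (cong (at (word v)) (sym (toℕ-fromℕ< x<k))) (at-word v (fromℕ< x<k))

length-word : ∀ {n k} (v : Vec (Fin n) k) → length (word v) ≡ k
length-word v = length-toList (Vec.map toℕ v)

word-injective : ∀ {n k} (v w : Vec (Fin n) k) → word v ≡ word w → v ≡ w
word-injective []      []      _  = refl
word-injective (a ∷ v) (b ∷ w) eq = cong₂ _∷_ (toℕ-injective (∷-injectiveˡ eq)) (word-injective v w (∷-injectiveʳ eq))

word-< : ∀ {n k} (v : Vec (Fin n) k) → All (_< n) (word v)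
word-< []      = []
word-< (a ∷ v) = toℕ<n a ∷ word-< v

word-surjective : ∀ n l → All (_< n) l → ∃ λ (v : Vec (Fin n) (length l)) → word v ≡ l
word-surjective n []      []           = [] , refl
word-surjective n (x ∷ l) (x<n ∷ l<n) with word-surjective n l l<n
... | v , word-v≡l = fromℕ< x<n ∷ v , cong₂ _∷_ (toℕ-fromℕ< x<n) word-v≡l

∈-words : ∀ n k (v : Vec (Fin n) k) → v ∈ words n k
∈-words n zero    []      = here refl
∈-words n (suc k) (a ∷ v) = ∈-concatMap⁺ (λ a → map (a ∷_) (words n k)) (∈-allFin a) (∈-map⁺ (a ∷_) (∈-words n k v))

Unique-words : ∀ n k → Unique (words n k)
Unique-words n zero    = [] ∷ []
Unique-words n (suc k) = concatMap-unique (λ a → map (a ∷_) (words n k)) (Unique.allFin⁺ n)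
  (λ _ → Unique.map⁺ Vec.∷-injectiveʳ (Unique-words n k)) same-head
  where
  same-head : ∀ {a a′ v} → a ∈ allFin n → a′ ∈ allFin n →
              v ∈ map (a ∷_) (words n k) → v ∈ map (a′ ∷_) (words n k) → a ≡ a′
  same-head _ _ p q with ∈-map⁻ (_ ∷_) p | ∈-map⁻ (_ ∷_) q
  ... | _ , _ , refl | _ , _ , refl = refl

des≡desL-word : ∀ {n} (π : Vec (Fin n) n) → des π ≡ desL (word π)
des≡desL-word π = trans (cong desL (pos-word π)) (desL-map-suc (word π))
  where
  pos-word : ∀ {n k} (v : Vec (Fin n) k) → map (λ x → pos x) (toList v) ≡ map suc (word v)
  pos-word []      = refl
  pos-word (a ∷ v) = cong (suc (toℕ a) ∷_) (pos-word v)
  desL-map-suc : ∀ l → desL (map suc l) ≡ desL l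
  desL-map-suc []          = refl
  desL-map-suc (a ∷ [])    = refl
  desL-map-suc (a ∷ b ∷ l) = cong (_+_ (if b <ᵇ a then 1 else 0)) (desL-map-suc (b ∷ l))

isPerm⇒Distinct : ∀ {n} (π : Vec (Fin n) n) → isPerm π ≡ true → Distinct (word π)
isPerm⇒Distinct {n} π perm x y x<y y<l eq = case subst₂ (λ a b → (not a ∨ not b) ≡ true) i<ᵇj same pair of λ ()
  where
  y<n : y < n
  y<n = subst (y <_) (length-word π) y<l
  x<n : x < n
  x<n = <-trans x<y y<n
  i j : Fin n
  i = fromℕ< x<n
  j = fromℕ< y<n
  pair : (not (toℕ i <ᵇ toℕ j) ∨ not (toℕ (lookup π i) ≡ᵇ toℕ (lookup π j))) ≡ true
  pair = all-true⇒ _ (allFin n) (all-true⇒ _ (allFin n) perm (∈-allFin i)) (∈-allFin j)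
  i<ᵇj : (toℕ i <ᵇ toℕ j) ≡ true
  i<ᵇj = trans (cong₂ _<ᵇ_ (toℕ-fromℕ< x<n) (toℕ-fromℕ< y<n)) (<⇒<ᵇ≡true x<y)
  same : (toℕ (lookup π i) ≡ᵇ toℕ (lookup π j)) ≡ true
  same = T-≡ .to (≡⇒≡ᵇ _ _ (trans (sym (at-word-fromℕ< π x<n)) (trans eq (at-word-fromℕ< π y<n))))

Distinct⇒isPerm : ∀ {n} (π : Vec (Fin n) n) → Distinct (word π) → isPerm π ≡ true
Distinct⇒isPerm {n} π distinct = ⇒all-true _ (allFin n) λ {i} _ → ⇒all-true _ (allFin n) λ {j} _ → pair-ok i j
  where
  pair-ok : ∀ i j → (not (pos i <ᵇ pos j) ∨ not (pos (lookup π i) ≡ᵇ pos (lookup π j))) ≡ true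
  pair-ok i j with toℕ i <ᵇ toℕ j in i<ᵇj
  ... | false = refl
  ... | true rewrite ≢⇒≡ᵇ≡false (toℕ (lookup π i)) (toℕ (lookup π j)) λ eq →
          distinct (toℕ i) (toℕ j) (<ᵇ≡true⇒< i<ᵇj) (subst (toℕ j <_) (sym (length-word π)) (toℕ<n j))
                   (trans (at-word π i) (trans eq (sym (at-word π j)))) = refl

module _ {n : ℕ} (π : Vec (Fin n) n) where

  value : Fin n → ℕ
  value x = toℕ (lookup π x)

  toℕ<|word| : ∀ x → toℕ x < length (word π)
  toℕ<|word| x = subst (toℕ x <_) (sym (length-word π)) (toℕ<n x)

  -- the four shaded boxes of pR, as they appear after unfolding `contains12`
  box₀₀ box₀₁ box₁₀ box₁₁ : Fin n → Fin n → Fin n → Bool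
  box₀₀ i j x = (toℕ x <ᵇ toℕ i) ∧ (value x <ᵇ value i)
  box₀₁ i j x = (toℕ x <ᵇ toℕ i) ∧ ((value i <ᵇ value x) ∧ (value x <ᵇ value j))
  box₁₀ i j x = ((toℕ i <ᵇ toℕ x) ∧ (toℕ x <ᵇ toℕ j)) ∧ (value x <ᵇ value i)
  box₁₁ i j x = ((toℕ i <ᵇ toℕ x) ∧ (toℕ x <ᵇ toℕ j)) ∧ ((value i <ᵇ value x) ∧ (value x <ᵇ value j))

  occursAt : Fin n → Fin n → Bool
  occursAt i j = (toℕ i <ᵇ toℕ j) ∧ ((value i <ᵇ value j) ∧
    (not (any (box₀₀ i j) (allFin n)) ∧ (not (any (box₀₁ i j) (allFin n)) ∧
    (not (any (box₁₀ i j) (allFin n)) ∧ (not (any (box₁₁ i j) (allFin n)) ∧ true)))))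

  FinOccurrence : Fin n → Fin n → Set
  FinOccurrence i j = toℕ i < toℕ j × value i < value j × (∀ x → toℕ x < toℕ j → value x < value j → toℕ x ≡ toℕ i)

  occursAt-true : ∀ {i j} → toℕ i < toℕ j → value i < value j →
    (∀ x → box₀₀ i j x ≢ true) → (∀ x → box₀₁ i j x ≢ true) →
    (∀ x → box₁₀ i j x ≢ true) → (∀ x → box₁₁ i j x ≢ true) → occursAt i j ≡ true
  occursAt-true {i} {j} i<j vi<vj e₀₀ e₀₁ e₁₀ e₁₁
    rewrite <⇒<ᵇ≡true i<j | <⇒<ᵇ≡true vi<vj
          | ⇒any-false (box₀₀ i j) (allFin n) (λ {x} _ → e₀₀ x)
          | ⇒any-false (box₀₁ i j) (allFin n) (λ {x} _ → e₀₁ x)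
          | ⇒any-false (box₁₀ i j) (allFin n) (λ {x} _ → e₁₀ x)
          | ⇒any-false (box₁₁ i j) (allFin n) (λ {x} _ → e₁₁ x) = refl

  FinOccurrence⇒occursAt : ∀ i j → FinOccurrence i j → occursAt i j ≡ true
  FinOccurrence⇒occursAt i j (i<j , vi<vj , sole) = occursAt-true i<j vi<vj empty₀₀ empty₀₁ empty₁₀ empty₁₁
    where
    empty₀₀ : ∀ x → box₀₀ i j x ≢ true
    empty₀₀ x in-box with ∧≡true⇒ in-box
    ... | x<i , vx<vi = <⇒≢ (<ᵇ≡true⇒< x<i) (sole x (<-trans (<ᵇ≡true⇒< x<i) i<j) (<-trans (<ᵇ≡true⇒< vx<vi) vi<vj))
    empty₀₁ : ∀ x → box₀₁ i j x ≢ true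
    empty₀₁ x in-box with ∧≡true⇒ in-box
    ... | x<i , in-values =
      <⇒≢ (<ᵇ≡true⇒< x<i) (sole x (<-trans (<ᵇ≡true⇒< x<i) i<j) (<ᵇ≡true⇒< (proj₂ (∧≡true⇒ in-values))))
    empty₁₀ : ∀ x → box₁₀ i j x ≢ true
    empty₁₀ x in-box with ∧≡true⇒ in-box
    ... | in-positions , vx<vi with ∧≡true⇒ in-positions
    ... | i<x , x<j = <⇒≢ (<ᵇ≡true⇒< i<x) (sym (sole x (<ᵇ≡true⇒< x<j) (<-trans (<ᵇ≡true⇒< vx<vi) vi<vj)))
    empty₁₁ : ∀ x → box₁₁ i j x ≢ true
    empty₁₁ x in-box with ∧≡true⇒ in-box
    ... | in-positions , in-values with ∧≡true⇒ in-positions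
    ... | i<x , x<j = <⇒≢ (<ᵇ≡true⇒< i<x) (sym (sole x (<ᵇ≡true⇒< x<j) (<ᵇ≡true⇒< (proj₂ (∧≡true⇒ in-values)))))

  occursAt⇒FinOccurrence : Distinct (word π) → ∀ i j → occursAt i j ≡ true → FinOccurrence i j
  occursAt⇒FinOccurrence distinct i j occ with ∧≡true⇒ occ
  ... | i<j , r₁ with ∧≡true⇒ r₁
  ... | vi<vj , r₂ with ∧≡true⇒ r₂
  ... | e₀₀ , r₃ with ∧≡true⇒ r₃
  ... | e₀₁ , r₄ with ∧≡true⇒ r₄
  ... | e₁₀ , r₅ with ∧≡true⇒ r₅
  ... | e₁₁ , _ = <ᵇ≡true⇒< i<j , <ᵇ≡true⇒< vi<vj , sole
    where
    distinct-values : ∀ x → toℕ x ≢ toℕ i → value x ≢ value i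
    distinct-values x x≢i vx≡vi = x≢i (Distinct⇒at-injective {word π} distinct (toℕ<|word| x) (toℕ<|word| i)
                                         (trans (at-word π x) (trans vx≡vi (sym (at-word π i)))))
    outside : ∀ {box : Fin n → Bool} → not (any box (allFin n)) ≡ true → ∀ x → box x ≢ true
    outside {box} empty x = not-any⇒ box (allFin n) empty (∈-allFin x)
    sole : ∀ x → toℕ x < toℕ j → value x < value j → toℕ x ≡ toℕ i
    sole x x<j vx<vj with <-cmp (toℕ x) (toℕ i) | <-cmp (value x) (value i)
    ... | tri≈ _ x≡i _ | _              = x≡i
    ... | tri< _ x≢i _ | tri≈ _ vx≡vi _ = ⊥-elim (distinct-values x x≢i vx≡vi)
    ... | tri> _ x≢i _ | tri≈ _ vx≡vi _ = ⊥-elim (distinct-values x x≢i vx≡vi)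
    ... | tri< x<i _ _ | tri< vx<vi _ _ = ⊥-elim (outside e₀₀ x (<ᵇ∧<ᵇ x<i vx<vi))
    ... | tri< x<i _ _ | tri> _ _ vi<vx = ⊥-elim (outside e₀₁ x (∧≡true⇐ (<⇒<ᵇ≡true x<i) (<ᵇ∧<ᵇ vi<vx vx<vj)))
    ... | tri> _ _ i<x | tri< vx<vi _ _ = ⊥-elim (outside e₁₀ x (∧≡true⇐ (<ᵇ∧<ᵇ i<x x<j) (<⇒<ᵇ≡true vx<vi)))
    ... | tri> _ _ i<x | tri> _ _ vi<vx = ⊥-elim (outside e₁₁ x (∧≡true⇐ (<ᵇ∧<ᵇ i<x x<j) (<ᵇ∧<ᵇ vi<vx vx<vj)))

  FinOccurrence⇒IsOccurrence : ∀ i j → FinOccurrence i j → IsOccurrence (word π) (toℕ i) (toℕ j)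
  FinOccurrence⇒IsOccurrence i j (i<j , vi<vj , sole) =
    i<j , toℕ<|word| j ,
    subst₂ _<_ (sym (at-word π i)) (sym (at-word π j)) vi<vj ,
    λ x x<j below → let x<n = <-trans x<j (toℕ<n j) in
      trans (sym (toℕ-fromℕ< x<n))
            (sole (fromℕ< x<n) (subst (_< toℕ j) (sym (toℕ-fromℕ< x<n)) x<j)
                  (subst₂ _<_ (at-word-fromℕ< π x<n) (at-word π j) below))

  IsOccurrence⇒FinOccurrence : ∀ i j → IsOccurrence (word π) i j → ∃₂ FinOccurrence
  IsOccurrence⇒FinOccurrence i j (i<j , j<l , below , sole) =
    fromℕ< i<n , fromℕ< j<n ,
    subst₂ _<_ (sym (toℕ-fromℕ< i<n)) (sym (toℕ-fromℕ< j<n)) i<j ,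
    subst₂ _<_ (at-word-fromℕ< π i<n) (at-word-fromℕ< π j<n) below ,
    λ x x<j vx<vj → trans (sole (toℕ x) (subst (toℕ x <_) (toℕ-fromℕ< j<n) x<j)
                                (subst₂ _<_ (sym (at-word π x)) (sym (at-word-fromℕ< π j<n)) vx<vj))
                          (sym (toℕ-fromℕ< i<n))
    where
    j<n : j < n
    j<n = subst (j <_) (length-word π) j<l
    i<n : i < n
    i<n = <-trans i<j j<n

  avoids12-pR≡avoidsAfter : isPerm π ≡ true → avoids12 pR π ≡ avoidsAfter [] (word π)
  avoids12-pR≡avoidsAfter perm with contains12 pR π in contains
  ... | true with any-true⇒ _ (allFin n) contains
  ...   | i , _ , occurs-i with any-true⇒ _ (allFin n) occurs-i
  ...     | j , _ , occurs-ij = sym (occurrence⇒avoidsAfter-false (word π) (toℕ i) (toℕ j)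
              (FinOccurrence⇒IsOccurrence i j (occursAt⇒FinOccurrence (isPerm⇒Distinct π perm) i j occurs-ij)))
  avoids12-pR≡avoidsAfter perm | false with avoidsAfter [] (word π) in avoids
  ... | true  = refl
  ... | false with avoidsAfter-false⇒occurrence (word π) avoids
  ...   | i , j , occ with IsOccurrence⇒FinOccurrence i j occ
  ...     | i′ , j′ , occ′ with trans (sym contains)
              (⇒any-true _ (allFin n) (∈-allFin i′) (⇒any-true _ (allFin n) (∈-allFin j′) (FinOccurrence⇒occursAt i′ j′ occ′)))
  ...       | ()

Av⇒IsAvoider : ∀ n {π} → π ∈ Av n pR → IsAvoider n (word π)
Av⇒IsAvoider n {π} π∈ with ∈-filter⁻ (T? ∘ avoids12 pR) {xs = S n} π∈
... | π∈S , avoids with ∈-filter⁻ (T? ∘ isPerm) {xs = words n n} π∈S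
... | _ , perm = length-word π , word-< π , Distinct⇒Unique (word π) (isPerm⇒Distinct π (T-≡ .to perm)) ,
                 trans (sym (avoids12-pR≡avoidsAfter π (T-≡ .to perm))) (T-≡ .to avoids)

Unique∧avoids⇒Av : ∀ {n} (π : Vec (Fin n) n) → Unique (word π) → avoidsAfter [] (word π) ≡ true → π ∈ Av n pR
Unique∧avoids⇒Av {n} π unique avoids =
  ∈-filter⁺ (T? ∘ avoids12 pR) π∈S (T-≡ .from (trans (avoids12-pR≡avoidsAfter π perm) avoids))
  where
  perm : isPerm π ≡ true
  perm = Distinct⇒isPerm π (Unique⇒Distinct (word π) unique)
  π∈S : π ∈ S n
  π∈S = ∈-filter⁺ (T? ∘ isPerm) (∈-words n n π) (T-≡ .from perm)

IsAvoider⇒Av : ∀ n {w} → IsAvoider n w → w ∈ map word (Av n pR)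
IsAvoider⇒Av n {w} (refl , w<n , unique , avoids) with word-surjective n w w<n
... | π , word-π≡w = subst (_∈ map word (Av n pR)) word-π≡w (∈-map⁺ word (Unique∧avoids⇒Av π
        (subst Unique (sym word-π≡w) unique) (subst (λ v → avoidsAfter [] v ≡ true) (sym word-π≡w) avoids)))

Unique-words-Av : ∀ n → Unique (map word (Av n pR))
Unique-words-Av n = Unique.map⁺ (word-injective _ _)
  (Unique.filter⁺ (T? ∘ avoids12 pR) (Unique.filter⁺ (T? ∘ isPerm) (Unique-words n n)))

words-Av↭avoiders : ∀ n → map word (Av n pR) ↭ avoiders n
words-Av↭avoiders n = ∼bag⇒↭ (unique∧set⇒bag (Unique-words-Av n) (Unique-avoiders n)
  (mk⇔ (λ w∈ → IsAvoider⇒avoiders n (word∈⇒IsAvoider w∈)) (IsAvoider⇒Av n ∘ avoiders⇒IsAvoider n)))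
  where
  word∈⇒IsAvoider : ∀ {w} → w ∈ map word (Av n pR) → IsAvoider n w
  word∈⇒IsAvoider w∈ with ∈-map⁻ word w∈
  ... | π , π∈ , refl = Av⇒IsAvoider n π∈

desGF-Av≡desCount : ∀ n k → desGF (Av n pR) k ≡ + desCount n k
desGF-Av≡desCount n k = cong +_ (begin
  length (filterᵇ (λ π → des π ≡ᵇ k) (Av n pR))   ≡⟨ length-filterᵇ-map des k (Av n pR) ⟩
  occurrences k (map des (Av n pR))                ≡⟨ cong (occurrences k) (trans (map-cong des≡desL-word (Av n pR)) (map-∘ (Av n pR))) ⟩
  occurrences k (map desL (map word (Av n pR)))    ≡⟨ occurrences-↭ k (↭.map⁺ desL (words-Av↭avoiders n)) ⟩
  occurrences k (map desL (avoiders n))            ≡⟨ length-filterᵇ-map desL k (avoiders n) ⟨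
  desCount n k                                     ∎)
  where open ≡-Reasoning

length-Av≡length-avoiders : ∀ n → length (Av n pR) ≡ length (avoiders n)
length-Av≡length-avoiders n = trans (sym (length-map word (Av n pR))) (↭.↭-length (words-Av↭avoiders n))

-- Comparison with the Eulerian recurrence

-- The truncated subtraction m ∸ k only agrees with the integer m - k when k ≤ m.
pos-∸-* : ∀ m k c → k ≤ m ⊎ c ≡ 0 → + ((m ∸ k) * c) ≡ (+ m ℤ.- + k) ℤ.* + c
pos-∸-* m k c (inj₁ k≤m) = trans (ℤ.pos-* (m ∸ k) c) (cong (ℤ._* + c) (sym (trans (ℤ.m-n≡m⊖n m k) (ℤ.⊖-≥ k≤m))))
pos-∸-* m k c (inj₂ refl) = trans (cong +_ (*-zeroʳ (m ∸ k))) (sym (ℤ.*-zeroʳ (+ m ℤ.- + k)))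

desCount≡xE : ∀ t k → + desCount (suc (suc t)) k ≡ xTimes (E (suc t)) k
desCount≡xE zero    zero          = refl
desCount≡xE zero    (suc zero)    = sym (E-one 0)
desCount≡xE zero    (suc (suc k)) = sym (E-one (suc k))
desCount≡xE (suc t) zero          = cong +_ (desCount-zero t)
desCount≡xE (suc t) (suc zero)    = begin
  + desCount (suc (suc (suc t))) 1                  ≡⟨ cong +_ (desCount-suc t 0) ⟩
  + (1 * c₁ + suc (suc t) * desCount (suc (suc t)) 0) ≡⟨ cong (λ c → + (1 * c₁ + suc (suc t) * c)) none ⟩
  + (1 * c₁ + suc (suc t) * 0)                      ≡⟨ cong +_ (cong₂ _+_ (*-identityˡ c₁) (*-zeroʳ (suc (suc t)))) ⟩
  + (c₁ + 0)                                        ≡⟨ cong +_ (+-identityʳ c₁) ⟩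
  + c₁                                              ≡⟨ desCount≡xE t 1 ⟩
  E (suc t) 0                                       ≡⟨ E-suc-zero (suc t) ⟨
  E (suc (suc t)) 0                                 ∎
  where
  open ≡-Reasoning
  c₁ : ℕ
  c₁ = desCount (suc (suc t)) 1
  none : desCount (suc (suc t)) 0 ≡ 0
  none = ℤ.+-injective (desCount≡xE t 0)
desCount≡xE (suc t) (suc (suc k)) = begin
  + desCount (suc (suc (suc t))) (suc (suc k))
    ≡⟨ cong +_ (desCount-suc t (suc k)) ⟩
  + (suc (suc k) * c₂ + (suc t ∸ k) * c₁)
    ≡⟨ ℤ.pos-+ (suc (suc k) * c₂) ((suc t ∸ k) * c₁) ⟩
  + (suc (suc k) * c₂) ℤ.+ + ((suc t ∸ k) * c₁)
    ≡⟨ cong₂ ℤ._+_ (ℤ.pos-* (suc (suc k)) c₂) (pos-∸-* (suc t) k c₁ in-range) ⟩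
  + suc (suc k) ℤ.* + c₂ ℤ.+ (+ suc t ℤ.- + k) ℤ.* + c₁
    ≡⟨ cong₂ (λ a b → + suc (suc k) ℤ.* a ℤ.+ (+ suc t ℤ.- + k) ℤ.* b) (desCount≡xE t (suc (suc k))) (desCount≡xE t (suc k)) ⟩
  + suc (suc k) ℤ.* E (suc t) (suc k) ℤ.+ (+ suc t ℤ.- + k) ℤ.* E (suc t) k
    ≡⟨ E-suc-suc (suc t) k ⟨
  E (suc (suc t)) (suc k) ∎
  where
  open ≡-Reasoning
  c₁ c₂ : ℕ
  c₁ = desCount (suc (suc t)) (suc k)
  c₂ = desCount (suc (suc t)) (suc (suc k))
  in-range : k ≤ suc t ⊎ c₁ ≡ 0
  in-range with k ≤? suc t
  ... | yes k≤1+t = inj₁ k≤1+t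
  ... | no  k≰1+t = inj₂ (desCount-vanishes (suc t) (suc k) (s≤s (<⇒≤ (≰⇒> k≰1+t))))

proposition4p5 : ((n : ℕ) → 2 ≤ n → (k : ℕ) → desGF (Av n pR) k ≡ xTimes (E (n ∸ 1)) k)
    × ((n : ℕ) → 1 ≤ n → length (Av n pR) ≡ (n ∸ 1) !)
proposition4p5 = descents , cardinality
  where
  descents : (n : ℕ) → 2 ≤ n → (k : ℕ) → desGF (Av n pR) k ≡ xTimes (E (n ∸ 1)) k
  descents (suc (suc t)) (s≤s (s≤s z≤n)) k = trans (desGF-Av≡desCount (suc (suc t)) k) (desCount≡xE t k)
  cardinality : (n : ℕ) → 1 ≤ n → length (Av n pR) ≡ (n ∸ 1) !
  cardinality (suc n) (s≤s z≤n) = trans (length-Av≡length-avoiders (suc n)) (length-avoiders n)
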